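{- Let $n,t,\lambda,s_1,s_2$ be positive integers with $n>t>1$ and $\min\{s_1+1,s_2+1\}\le\lambda\le s_1+s_2$. Set $\chi=\max\{\lceil t/s_1\rceil,\lceil (n-t)/s_2\rceil\}$. Then \[m(n,t,\lambda;s_1+1,s_2+1)\le\frac{1}{n}\binom{n}{t}(\lambda-1)\left\lceil\frac{n}{\lfloor n/\chi\rfloor}\right\rceil.\]
   Context: $[m]=\{1,\dots,m\}$. A sequence $A_1,\dots,A_\lambda$ of subsets of $[n]$ (repetitions allowed) is $k_1$-disjoint if $\bigcap_{i\in B}A_i=\emptyset$ for every $k_1$-subset $B\subseteq[\lambda]$ (vacuous if $k_1>\lambda$), $k_2$-covering if $\bigcup_{i\in B}A_i=[n]$ for every $k_2$-subset $B\subseteq[\lambda]$ (vacuous if $k_2>\lambda$), and $(k_1,k_2)$-disjoint if both hold. $m(n,t,\lambda;k_1,k_2)$ is the maximum size of a family $\mathcal{F}$ of $t$-subsets of $[n]$ such that no $A_1,\dots,A_\lambda\in\mathcal{F}$ (not necessarily distinct) form a $(k_1,k_2)$-disjoint sequence. -}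

module Defs where

open import Data.Nat using (ℕ; zero; suc; _+_; _∸_; _⊔_; _/_)
open import Data.Fin using (Fin)
open import Data.Fin.Subset using (Subset; _∈_; ∣_∣)
open import Data.Product using (Σ; _×_; ∃)
open import Data.List using (List)
open import Data.List.Relation.Unary.All using (All)
open import Data.List.Relation.Unary.Unique.Propositional using (Unique)
import Data.List.Membership.Propositional as L
open import Relation.Binary.PropositionalEquality using (_≡_)
open import Relation.Nullary using (¬_)

-- k-disjoint: the intersection over every k-subset B ⊆ [λ] is empty
-- (vacuous when k > λ since no such B exists).
Disjoint : {n l : ℕ} → ℕ → (Fin l → Subset n) → Set
Disjoint {n} {l} k A =
  (B : Subset l) → ∣ B ∣ ≡ k → (x : Fin n) → ¬ ((i : Fin l) → i ∈ B → x ∈ A i)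

Covering : {n l : ℕ} → ℕ → (Fin l → Subset n) → Set
Covering {n} {l} k A =
  (B : Subset l) → ∣ B ∣ ≡ k → (x : Fin n) → ∃ λ (i : Fin l) → (i ∈ B) × (x ∈ A i)

DisjCov : {n l : ℕ} → ℕ → ℕ → (Fin l → Subset n) → Set
DisjCov k₁ k₂ A = Disjoint k₁ A × Covering k₂ A

Admissible : (n t l k₁ k₂ : ℕ) → List (Subset n) → Set
Admissible n t l k₁ k₂ F =
  Unique F × All (λ A → ∣ A ∣ ≡ t) F ×
  ((A : Fin l → Subset n) → ((i : Fin l) → A i L.∈ F) → ¬ DisjCov k₁ k₂ A)

-- floor and ceiling division (divisor 0 never occurs in the theorem;
-- we return 0 there by convention).
⌊_/_⌋ : ℕ → ℕ → ℕ
⌊ a / zero ⌋ = 0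
⌊ a / suc b ⌋ = a / suc b

⌈_/_⌉ : ℕ → ℕ → ℕ
⌈ a / zero ⌉ = 0
⌈ a / suc b ⌉ = (a + b) / suc b

{-# OPTIONS --safe #-}
module Submission where

open import Defs
open import Data.Nat using (ℕ; _+_; _*_; _∸_; _⊔_; _≤_; _<_; _⊓_)
open import Data.Nat.Combinatorics using (_C_)
open import Data.Fin.Subset using (Subset)
open import Data.List using (List; length)

-- Put q = ⌊n/χ⌋.  Cutting 1, …, q t into q consecutive blocks of length t and reducing mod n
-- gives q t-subsets of [n] (cyclic intervals) such that every point lies in at most s₁ and
-- outside at most s₂ of them, because q t ≤ s₁ n and q (n - t) ≤ s₂ n.  Hence for every
-- permutation π of [n], any λ of the π-images of these blocks would form an (s₁+1, s₂+1)-disjoint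
-- sequence, so fewer than λ of them lie in F.  Summing over all n! permutations, where a fixed
-- t-set is the π-image of a fixed block for exactly t! (n - t)! of them, gives
-- q |F| t! (n - t)! ≤ n! (λ - 1), that is q |F| ≤ C(n,t) (λ - 1); finally n ≤ q ⌈n/q⌉.

open import Data.Bool using (Bool; true; false; not; _∧_; T)
import Data.Bool as Bool
open import Data.Empty using (⊥-elim)
open import Data.Fin using (Fin; zero; suc; toℕ; punchOut)
import Data.Fin.Properties as Fin
open import Data.Fin.Properties using (toℕ<n; toℕ-inject₁; toℕ-fromℕ; any?)
open import Data.Fin.Subset using (_∈_; ∣_∣; ∁)
open import Data.Fin.Subset.Properties using (_∈?_; ∣p∣≤n; ∣∁p∣≡n∸∣p∣)
import Data.List as List
open import Data.List.Membership.Propositional using () renaming (_∈_ to _∈ˡ_)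
open import Data.List.Membership.Propositional.Properties using (∈-lookup)
open import Data.List.Relation.Unary.All as All using (All)
open import Data.List.Relation.Unary.AllPairs using ([]; _∷_)
open import Data.List.Relation.Unary.Unique.Propositional using (Unique)
open import Data.Nat using (zero; suc; z≤n; s≤s; s≤s⁻¹; _>_; _<ᵇ_; _!; NonZero; >-nonZero)
open import Data.Nat.Combinatorics using (k![n∸k]!∣n!)
open import Data.Nat.Combinatorics.Specification using (nCk≡n!/k![n-k]!)
open import Data.Nat.Divisibility using (∣-refl)
open import Data.Nat.DivMod
open import Data.Nat.Properties
open import Data.Product using (Σ-syntax; ∃-syntax; _×_; _,_; proj₁; proj₂)
open import Data.Unit using (tt)
open import Data.Vec using (_∷_; []; here; there; lookup; tabulate)
open import Data.Vec.Functional as V using (Vector)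
open import Data.Vec.Functional.Properties using (removeAt-punchOut)
open import Data.Vec.Properties using (≡-dec; []=⇒lookup; lookup⇒[]=; lookup∘tabulate; tabulate∘lookup; tabulate-cong)
open import Function using (_∘_; id)
open import Relation.Binary.Definitions using (DecidableEquality)
open import Relation.Binary.PropositionalEquality
open import Relation.Nullary using (¬_; yes; no; does; isYes; _×-dec_)
open import Relation.Nullary.Decidable using (dec-true; dec-false; toWitness)
open import Algebra.Properties.CommutativeSemigroup *-commutativeSemigroup using (x∙yz≈y∙xz; xy∙z≈xz∙y)
open import Algebra.Properties.Semiring.Sum +-*-semiring
  using (sum; sum-syntax; sum-cong-≗; sum-remove; ∑-distrib-+; ∑-comm; *-distribʳ-sum; sum-init-last)

sum-mono-≤ : ∀ {n} {f g : Vector ℕ n} → (∀ i → f i ≤ g i) → sum f ≤ sum g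
sum-mono-≤ {zero}  f≤g = z≤n
sum-mono-≤ {suc n} f≤g = +-mono-≤ (f≤g zero) (sum-mono-≤ (f≤g ∘ suc))

sum-const : ∀ n c → ∑[ i < n ] c ≡ n * c
sum-const zero    c = refl
sum-const (suc n) c = cong (c +_) (sum-const n c)

sum-zero : ∀ {n} {f : Vector ℕ n} → (∀ i → f i ≡ 0) → sum f ≡ 0
sum-zero {n} f≗0 = trans (sum-cong-≗ {n} f≗0) (trans (sum-const n 0) (*-zeroʳ n))

sum-last : ∀ n (g : ℕ → ℕ) → ∑[ i < suc n ] g (toℕ i) ≡ ∑[ i < n ] g (toℕ i) + g n
sum-last n g = trans (sum-init-last {n} (g ∘ toℕ))
  (cong₂ _+_ (sum-cong-≗ {n} (cong g ∘ toℕ-inject₁)) (cong g (toℕ-fromℕ n)))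

sum-telescope : ∀ q (g : ℕ → ℕ) → (∀ j → g j ≤ g (suc j)) →
                g 0 + ∑[ i < q ] (g (suc (toℕ i)) ∸ g (toℕ i)) ≡ g q
sum-telescope zero    g g-mono = +-identityʳ (g 0)
sum-telescope (suc q) g g-mono = begin
  g 0 + ((g 1 ∸ g 0) + rest)  ≡⟨ +-assoc (g 0) _ rest ⟨
  g 0 + (g 1 ∸ g 0) + rest    ≡⟨ cong (_+ rest) (m+[n∸m]≡n (g-mono 0)) ⟩
  g 1 + rest                  ≡⟨ sum-telescope q (g ∘ suc) (g-mono ∘ suc) ⟩
  g (suc q)                   ∎
  where
  open ≡-Reasoning
  rest : ℕ
  rest = ∑[ i < q ] (g (2 + toℕ i) ∸ g (1 + toℕ i))

𝟙 : Bool → ℕ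
𝟙 true  = 1
𝟙 false = 0

count : ∀ {n} → Vector Bool n → ℕ
count {n} P = ∑[ i < n ] 𝟙 (P i)

∣x∷p∣≡𝟙x+∣p∣ : ∀ {n} x (p : Subset n) → ∣ x ∷ p ∣ ≡ 𝟙 x + ∣ p ∣
∣x∷p∣≡𝟙x+∣p∣ true  p = refl
∣x∷p∣≡𝟙x+∣p∣ false p = refl

∣p∣≡count : ∀ {n} (p : Subset n) → ∣ p ∣ ≡ count (lookup p)
∣p∣≡count []      = refl
∣p∣≡count (x ∷ p) = trans (∣x∷p∣≡𝟙x+∣p∣ x p) (cong (𝟙 x +_) (∣p∣≡count p))

∣tabulate∣≡count : ∀ {n} (P : Vector Bool n) → ∣ tabulate P ∣ ≡ count P
∣tabulate∣≡count {n} P = trans (∣p∣≡count (tabulate P)) (sum-cong-≗ {n} (cong 𝟙 ∘ lookup∘tabulate P))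

count-complement : ∀ {n} (P : Vector Bool n) → count P + count (not ∘ P) ≡ n
count-complement {zero}  P = refl
count-complement {suc n} P with P zero
... | true  = cong suc (count-complement (P ∘ suc))
... | false = trans (+-suc _ _) (cong suc (count-complement (P ∘ suc)))

count-not : ∀ {n} (P : Vector Bool n) (p : Subset n) → count P ≡ ∣ p ∣ → count (not ∘ P) ≡ ∣ ∁ p ∣
count-not {n} P p count≡∣p∣ = +-cancelˡ-≡ ∣ p ∣ _ _ (begin
  ∣ p ∣ + count (not ∘ P)  ≡⟨ cong (_+ count (not ∘ P)) count≡∣p∣ ⟨
  count P + count (not ∘ P) ≡⟨ count-complement P ⟩
  n                         ≡⟨ m+[n∸m]≡n (∣p∣≤n p) ⟨
  ∣ p ∣ + (n ∸ ∣ p ∣)       ≡⟨ cong (∣ p ∣ +_) (∣∁p∣≡n∸∣p∣ p) ⟨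
  ∣ p ∣ + ∣ ∁ p ∣           ∎)
  where open ≡-Reasoning

∣p∣≤count : ∀ {n} (p : Subset n) (P : Vector Bool n) → (∀ i → i ∈ p → P i ≡ true) → ∣ p ∣ ≤ count P
∣p∣≤count []          P p⊆P = z≤n
∣p∣≤count (true ∷ p)  P p⊆P rewrite p⊆P zero here =
  s≤s (∣p∣≤count p (P ∘ suc) (λ i i∈p → p⊆P (suc i) (there i∈p)))
∣p∣≤count (false ∷ p) P p⊆P =
  ≤-trans (∣p∣≤count p (P ∘ suc) (λ i i∈p → p⊆P (suc i) (there i∈p))) (m≤n+m _ (𝟙 (P zero)))

𝟙[m<ᵇn]≡n∸m : ∀ {m n} → m ≤ n → n ≤ suc m → 𝟙 (m <ᵇ n) ≡ n ∸ m
𝟙[m<ᵇn]≡n∸m {m} {n} m≤n n≤1+m with m <ᵇ n in m<ᵇn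
... | true  rewrite ≤-antisym n≤1+m (<ᵇ⇒< m n (subst T (sym m<ᵇn) tt))      = sym (m+n∸n≡m 1 m)
... | false rewrite ≤-antisym (≮⇒≥ (λ m<n → subst T m<ᵇn (<⇒<ᵇ m<n))) m≤n = sym (n∸n≡0 m)

-- level p N counts the multiples of n in (p, N + p], so row i p holds iff N + p ≡ 0 (mod n) for
-- some N in (i t, (i + 1) t]: row i is a cyclic interval of t consecutive points, and the first
-- q rows cover the point p exactly ⌊(q t + p) / n⌋ times.
module CyclicDesign (n t : ℕ) .{{_ : NonZero n}} (t≤n : t ≤ n) where

  level : Fin n → ℕ → ℕ
  level p N = (N + toℕ p) / n

  level-mono : ∀ p {N N′} → N ≤ N′ → level p N ≤ level p N′
  level-mono p N≤N′ = /-monoˡ-≤ n (+-monoˡ-≤ (toℕ p) N≤N′)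

  level-step : ∀ p N → level p (t + N) ≤ suc (level p N)
  level-step p N = begin
    level p (t + N)        ≤⟨ level-mono p (+-monoˡ-≤ N t≤n) ⟩
    (n + N + toℕ p) / n    ≡⟨ cong (_/ n) (+-assoc n N (toℕ p)) ⟩
    (n + (N + toℕ p)) / n  ≡⟨ +-distrib-/-∣ˡ (N + toℕ p) ∣-refl ⟩
    n / n + level p N      ≡⟨ cong (_+ level p N) (n/n≡1 n) ⟩
    suc (level p N)        ∎
    where open ≤-Reasoning

  hermite-identity : ∀ N → ∑[ p < n ] level p N ≡ N
  hermite-identity zero    = sum-zero (λ p → m<n⇒m/n≡0 (toℕ<n p))
  hermite-identity (suc N) = +-cancelʳ-≡ (g 0) _ _ (begin
    ∑[ p < n ] level p (suc N) + g 0  ≡⟨ cong (_+ g 0) (sum-cong-≗ {n} (λ p → cong (_/ n) (+-suc N (toℕ p)))) ⟨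
    ∑[ p < n ] g (suc (toℕ p)) + g 0  ≡⟨ +-comm _ (g 0) ⟩
    ∑[ p < suc n ] g (toℕ p)          ≡⟨ sum-last n g ⟩
    ∑[ p < n ] g (toℕ p) + g n        ≡⟨ cong₂ _+_ (hermite-identity N) g[n]≡1+g[0] ⟩
    N + suc (g 0)                     ≡⟨ +-suc N (g 0) ⟩
    suc N + g 0                       ∎)
    where
    open ≡-Reasoning
    g : ℕ → ℕ
    g k = (N + k) / n
    g[n]≡1+g[0] : g n ≡ suc (g 0)
    g[n]≡1+g[0] = begin
      (N + n) / n    ≡⟨ +-distrib-/-∣ʳ N ∣-refl ⟩
      N / n + n / n  ≡⟨ cong₂ _+_ (cong (_/ n) (sym (+-identityʳ N))) (n/n≡1 n) ⟩
      g 0 + 1        ≡⟨ +-comm (g 0) 1 ⟩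
      suc (g 0)      ∎

  row : ℕ → Vector Bool n
  row i p = level p (i * t) <ᵇ level p (t + i * t)

  𝟙-row : ∀ i p → 𝟙 (row i p) ≡ level p (t + i * t) ∸ level p (i * t)
  𝟙-row i p = 𝟙[m<ᵇn]≡n∸m (level-mono p (m≤n+m (i * t) t)) (level-step p (i * t))

  count-row : ∀ i → count (row i) ≡ t
  count-row i = +-cancelʳ-≡ N _ _ (begin
    count (row i) + N                     ≡⟨ cong (count (row i) +_) (hermite-identity N) ⟨
    count (row i) + ∑[ p < n ] level p N  ≡⟨ ∑-distrib-+ (𝟙 ∘ row i) (λ p → level p N) ⟨
    ∑[ p < n ] (𝟙 (row i p) + level p N)  ≡⟨ sum-cong-≗ {n} (λ p → trans (cong (_+ level p N) (𝟙-row i p))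
                                                                   (m∸n+n≡m (level-mono p (m≤n+m N t)))) ⟩
    ∑[ p < n ] level p (t + N)            ≡⟨ hermite-identity (t + N) ⟩
    t + N                                 ∎)
    where
    open ≡-Reasoning
    N : ℕ
    N = i * t

  column : ∀ q → Fin n → Vector Bool q
  column q p i = row (toℕ i) p

  count-column : ∀ q p → count (column q p) ≡ level p (q * t)
  count-column q p = begin
    count (column q p)  ≡⟨ sum-cong-≗ {q} (λ i → 𝟙-row (toℕ i) p) ⟩
    0 + jumps           ≡⟨ cong (_+ jumps) (m<n⇒m/n≡0 (toℕ<n p)) ⟨
    G 0 + jumps         ≡⟨ sum-telescope q G (λ j → level-mono p (m≤n+m (j * t) t)) ⟩
    G q                 ∎
    where
    open ≡-Reasoning
    G : ℕ → ℕ
    G j = level p (j * t)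
    jumps : ℕ
    jumps = ∑[ i < q ] (G (suc (toℕ i)) ∸ G (toℕ i))

  count-column-≤ : ∀ q {s} p → q * t ≤ s * n → count (column q p) ≤ s
  count-column-≤ q {s} p qt≤sn = s≤s⁻¹ (begin-strict
    count (column q p)   ≡⟨ count-column q p ⟩
    (q * t + toℕ p) / n  <⟨ m<n*o⇒m/o<n (begin-strict
       q * t + toℕ p  <⟨ +-monoʳ-< (q * t) (toℕ<n p) ⟩
       q * t + n      ≤⟨ +-monoˡ-≤ n qt≤sn ⟩
       s * n + n      ≡⟨ +-comm (s * n) n ⟩
       suc s * n      ∎) ⟩
    suc s                ∎)
    where open ≤-Reasoning

  count-column-complement-≤ : ∀ q {s} p → q * (n ∸ t) ≤ s * n → count (not ∘ column q p) ≤ s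
  count-column-complement-≤ q {s} p q[n∸t]≤sn = +-cancelˡ-≤ c _ _ (begin
    c + count (not ∘ column q p)  ≡⟨ count-complement (column q p) ⟩
    q                             ≤⟨ m≤n+m∸n q s ⟩
    s + (q ∸ s)                   ≤⟨ +-monoʳ-≤ s q∸s≤c ⟩
    s + c                         ≡⟨ +-comm s c ⟩
    c + s                         ∎)
    where
    open ≤-Reasoning
    c : ℕ
    c = count (column q p)
    qn≤sn+qt : q * n ≤ s * n + q * t
    qn≤sn+qt = begin
      q * n                ≡⟨ cong (q *_) (m∸n+n≡m t≤n) ⟨
      q * (n ∸ t + t)      ≡⟨ *-distribˡ-+ q (n ∸ t) t ⟩
      q * (n ∸ t) + q * t  ≤⟨ +-monoˡ-≤ (q * t) q[n∸t]≤sn ⟩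
      s * n + q * t        ∎
    q∸s≤c : q ∸ s ≤ c
    q∸s≤c = begin
      q ∸ s                ≡⟨ m*n/n≡m (q ∸ s) n ⟨
      (q ∸ s) * n / n      ≡⟨ cong (_/ n) (*-distribʳ-∸ n q s) ⟩
      (q * n ∸ s * n) / n  ≤⟨ /-monoˡ-≤ n (≤-trans (m≤n+o⇒m∸n≤o (q * n) (s * n) qn≤sn+qt) (m≤m+n (q * t) (toℕ p))) ⟩
      (q * t + toℕ p) / n  ≡⟨ count-column q p ⟨
      c                    ∎

disjCov-from-degrees : ∀ {n l} (M : Fin l → Vector Bool n) s₁ s₂ →
                       (∀ x → count (λ k → M k x) ≤ s₁) →
                       (∀ x → count (λ k → not (M k x)) ≤ s₂) →
                       DisjCov (s₁ + 1) (s₂ + 1) (tabulate ∘ M)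
disjCov-from-degrees M s₁ s₂ degree≤s₁ codegree≤s₂ = disjoint , covering
  where
  ∈⇒true : ∀ {k x} → x ∈ tabulate (M k) → M k x ≡ true
  ∈⇒true {k} {x} x∈Mₖ = trans (sym (lookup∘tabulate (M k) x)) ([]=⇒lookup x∈Mₖ)

  ∉⇒false : ∀ {k x} → ¬ x ∈ tabulate (M k) → not (M k x) ≡ true
  ∉⇒false {k} {x} x∉Mₖ with M k x in eq
  ... | true  = ⊥-elim (x∉Mₖ (lookup⇒[]= x _ (trans (lookup∘tabulate (M k) x) eq)))
  ... | false = refl

  disjoint : Disjoint (s₁ + 1) (tabulate ∘ M)
  disjoint B ∣B∣≡s₁+1 x x∈⋂M = <⇒≱ (m<m+n s₁ (s≤s z≤n)) (begin
    s₁ + 1                ≡⟨ ∣B∣≡s₁+1 ⟨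
    ∣ B ∣                 ≤⟨ ∣p∣≤count B _ (λ k k∈B → ∈⇒true (x∈⋂M k k∈B)) ⟩
    count (λ k → M k x)  ≤⟨ degree≤s₁ x ⟩
    s₁                    ∎)
    where open ≤-Reasoning

  covering : Covering (s₂ + 1) (tabulate ∘ M)
  covering B ∣B∣≡s₂+1 x with any? (λ k → k ∈? B ×-dec x ∈? tabulate (M k))
  ... | yes (k , k∈B , x∈Mₖ) = k , k∈B , x∈Mₖ
  ... | no ∄ = ⊥-elim (<⇒≱ (m<m+n s₂ (s≤s z≤n)) (begin
    s₂ + 1                      ≡⟨ ∣B∣≡s₂+1 ⟨
    ∣ B ∣                       ≤⟨ ∣p∣≤count B _ (λ k k∈B → ∉⇒false (λ x∈Mₖ → ∄ (k , k∈B , x∈Mₖ))) ⟩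
    count (λ k → not (M k x))  ≤⟨ codegree≤s₂ x ⟩
    s₂                          ∎))
    where open ≤-Reasoning

select : ∀ {q} l (c : Vector Bool q) → l ≤ count c →
         Σ[ e ∈ (Fin l → Fin q) ] (∀ k → T (c (e k))) × (∀ P → count (P ∘ e) ≤ count P)
select zero c _ = (λ ()) , (λ ()) , (λ _ → z≤n)
select {suc q} (suc l) c l<count with c zero in c₀
... | true  = let e , c∘e , e-count = select l (c ∘ suc) (s≤s⁻¹ l<count) in
  (zero V.∷ suc ∘ e) ,
  (λ { zero → subst T (sym c₀) tt ; (suc k) → c∘e k }) ,
  (λ P → +-monoʳ-≤ (𝟙 (P zero)) (e-count (P ∘ suc)))
... | false = let e , c∘e , e-count = select (suc l) (c ∘ suc) l<count in
  suc ∘ e , c∘e , (λ P → ≤-trans (e-count (P ∘ suc)) (m≤n+m _ (𝟙 (P zero))))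

_==_ : Bool → Bool → Bool
b == true  = b
b == false = not b

==⇒≡ : ∀ b c → b == c ≡ true → b ≡ c
==⇒≡ true  true  _ = refl
==⇒≡ false false _ = refl

module _ {a} {X : Set a} where

  -- The sum of g over the n! orderings π of the entries of xs (entries are told apart by position).
  arrangementSum : ∀ {n} → Vector X n → (Vector X n → ℕ) → ℕ
  arrangementSum {zero}  xs g = g V.[]
  arrangementSum {suc n} xs g = ∑[ i < suc n ] arrangementSum (V.removeAt xs i) (λ π → g (xs i V.∷ π))

  arrangementSum-∑ : ∀ {n} (xs : Vector X n) m (h : Fin m → Vector X n → ℕ) →
                     arrangementSum xs (λ π → ∑[ i < m ] h i π) ≡ ∑[ i < m ] arrangementSum xs (h i)
  arrangementSum-∑ {zero}  xs m h = refl
  arrangementSum-∑ {suc n} xs m h = trans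
    (sum-cong-≗ {suc n} (λ j → arrangementSum-∑ (V.removeAt xs j) m (λ i π → h i (xs j V.∷ π))))
    (∑-comm {suc n} {m} (λ j i → arrangementSum (V.removeAt xs j) (λ π → h i (xs j V.∷ π))))

  arrangementSum-zero : ∀ {n} (xs : Vector X n) → arrangementSum xs (λ _ → 0) ≡ 0
  arrangementSum-zero xs = arrangementSum-∑ xs 0 (λ ())

  Covers : ∀ {n} → Vector X n → Vector X n → Set a
  Covers xs π = ∀ k → ∃[ j ] π j ≡ xs k

  ∷-Covers : ∀ {n} (xs : Vector X (suc n)) i π → Covers (V.removeAt xs i) π → Covers xs (xs i V.∷ π)
  ∷-Covers xs i π covers k with i Fin.≟ k
  ... | yes refl = zero , refl
  ... | no i≢k   = let j , πj≡ = covers (punchOut i≢k) in suc j , trans πj≡ (removeAt-punchOut xs i≢k)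

  arrangementSum-≤ : ∀ {n} (xs : Vector X n) (g : Vector X n → ℕ) c →
                     (∀ π → Covers xs π → g π ≤ c) → arrangementSum xs g ≤ n ! * c
  arrangementSum-≤ {zero}  xs g c g≤c = ≤-trans (g≤c V.[] (λ ())) (m≤m+n c 0)
  arrangementSum-≤ {suc n} xs g c g≤c = begin
    arrangementSum xs g       ≤⟨ sum-mono-≤ (λ i → arrangementSum-≤ (V.removeAt xs i) _ c
                                   (λ π covers → g≤c (xs i V.∷ π) (∷-Covers xs i π covers))) ⟩
    ∑[ i < suc n ] (n ! * c)  ≡⟨ sum-const (suc n) (n ! * c) ⟩
    suc n * (n ! * c)         ≡⟨ *-assoc (suc n) (n !) c ⟨
    suc n ! * c               ∎
    where open ≤-Reasoning

  matches : ∀ {n} → (X → Bool) → Vector X n → Subset n → Bool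
  matches χ π []      = true
  matches χ π (b ∷ p) = (χ (V.head π) == b) ∧ matches χ (V.tail π) p

  matches⇒lookup : ∀ {n} (χ : X → Bool) π (p : Subset n) → matches χ π p ≡ true → ∀ j → χ (π j) ≡ lookup p j
  matches⇒lookup χ π (b ∷ p) eq j with χ (π zero) == b in eq₀
  matches⇒lookup χ π (b ∷ p) eq zero    | true = ==⇒≡ _ b eq₀
  matches⇒lookup χ π (b ∷ p) eq (suc j) | true = matches⇒lookup χ (V.tail π) p eq j

  arrangementSum-matches : ∀ {n} (χ : X → Bool) (xs : Vector X n) (p : Subset n) → count (χ ∘ xs) ≡ ∣ p ∣ →
                           arrangementSum xs (λ π → 𝟙 (matches χ π p)) ≡ ∣ p ∣ ! * ∣ ∁ p ∣ !
  arrangementSum-matches {zero}  χ xs []      _        = refl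
  arrangementSum-matches {suc n} χ xs (b ∷ p) count≡∣p∣ = begin
    ∑[ i < suc n ] arrangementSum (V.removeAt xs i) (λ π → 𝟙 ((χ (xs i) == b) ∧ matches χ π p))
                                          ≡⟨ sum-cong-≗ {suc n} term ⟩
    ∑[ i < suc n ] (𝟙 (χ (xs i) == b) * K) ≡⟨ *-distribʳ-sum K (λ i → 𝟙 (χ (xs i) == b)) ⟨
    count (λ i → χ (xs i) == b) * K       ≡⟨ factorials b count≡∣p∣ ⟩
    ∣ b ∷ p ∣ ! * ∣ ∁ (b ∷ p) ∣ !         ∎
    where
    open ≡-Reasoning
    K = ∣ p ∣ ! * ∣ ∁ p ∣ !

    term : ∀ i → arrangementSum (V.removeAt xs i) (λ π → 𝟙 ((χ (xs i) == b) ∧ matches χ π p))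
                 ≡ 𝟙 (χ (xs i) == b) * K
    term i with χ (xs i) == b in χxᵢ==b
    ... | false = arrangementSum-zero (V.removeAt xs i)
    ... | true  = trans (arrangementSum-matches χ (V.removeAt xs i) p count-removeAt) (sym (+-identityʳ K))
      where
      count-removeAt : count (χ ∘ V.removeAt xs i) ≡ ∣ p ∣
      count-removeAt = +-cancelˡ-≡ (𝟙 b) _ _ (begin
        𝟙 b + count (χ ∘ V.removeAt xs i)         ≡⟨ cong (λ c → 𝟙 c + _) (==⇒≡ _ b χxᵢ==b) ⟨
        𝟙 (χ (xs i)) + count (χ ∘ V.removeAt xs i) ≡⟨ sum-remove {i = i} (𝟙 ∘ χ ∘ xs) ⟨
        count (χ ∘ xs)                            ≡⟨ count≡∣p∣ ⟩
        ∣ b ∷ p ∣                                 ≡⟨ ∣x∷p∣≡𝟙x+∣p∣ b p ⟩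
        𝟙 b + ∣ p ∣                               ∎)

    factorials : ∀ b → count (χ ∘ xs) ≡ ∣ b ∷ p ∣ →
                 count (λ i → χ (xs i) == b) * K ≡ ∣ b ∷ p ∣ ! * ∣ ∁ (b ∷ p) ∣ !
    factorials true  count≡ = trans (cong (_* K) count≡) (sym (*-assoc (suc ∣ p ∣) (∣ p ∣ !) (∣ ∁ p ∣ !)))
    factorials false count≡ = begin
      count (not ∘ χ ∘ xs) * K              ≡⟨ cong (_* K) (count-not (χ ∘ xs) (false ∷ p) count≡) ⟩
      suc ∣ ∁ p ∣ * (∣ p ∣ ! * ∣ ∁ p ∣ !)  ≡⟨ x∙yz≈y∙xz (suc ∣ ∁ p ∣) (∣ p ∣ !) (∣ ∁ p ∣ !) ⟩
      ∣ p ∣ ! * suc ∣ ∁ p ∣ !              ∎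

module _ {a} {A : Set a} (_≟_ : DecidableEquality A) where
  open import Data.List.Membership.DecPropositional _≟_ using () renaming (_∈?_ to _∈ˡ?_)

  multiplicity : List A → A → ℕ
  multiplicity xs y = ∑[ j < length xs ] 𝟙 (does (List.lookup xs j ≟ y))

  multiplicity-∉ : ∀ xs {y} → (∀ j → List.lookup xs j ≢ y) → multiplicity xs y ≡ 0
  multiplicity-∉ xs {y} xs≢y = sum-zero (λ j → cong 𝟙 (dec-false (List.lookup xs j ≟ y) (xs≢y j)))

  multiplicity-≤1 : ∀ {xs} y → Unique xs → multiplicity xs y ≤ 1
  multiplicity-≤1 y [] = z≤n
  multiplicity-≤1 {x List.∷ xs} y (x∉xs ∷ xs-unique) with x ≟ y
  ... | yes refl = ≤-reflexive (cong suc (multiplicity-∉ xs (λ j → ≢-sym (All.lookup x∉xs (∈-lookup j)))))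
  ... | no _     = multiplicity-≤1 y xs-unique

  multiplicity-≤-∈ : ∀ {xs} y → Unique xs → multiplicity xs y ≤ 𝟙 (isYes (y ∈ˡ? xs))
  multiplicity-≤-∈ {xs} y xs-unique with y ∈ˡ? xs
  ... | yes _   = multiplicity-≤1 y xs-unique
  ... | no y∉xs = ≤-reflexive (multiplicity-∉ xs (λ j xsⱼ≡y → y∉xs (subst (_∈ˡ xs) xsⱼ≡y (∈-lookup j))))

module DoubleCounting (n t q s₁ s₂ l : ℕ) .{{_ : NonZero n}} (t≤n : t ≤ n)
  (qt≤s₁n : q * t ≤ s₁ * n) (q[n∸t]≤s₂n : q * (n ∸ t) ≤ s₂ * n) (F : List (Subset n))
  (F-unique : Unique F) (F-sizes : All (λ A → ∣ A ∣ ≡ t) F)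
  (F-free : (A : Fin l → Subset n) → (∀ k → A k ∈ˡ F) → ¬ DisjCov (s₁ + 1) (s₂ + 1) A) where

  open CyclicDesign n t t≤n

  _≟ₛ_ : DecidableEquality (Subset n)
  _≟ₛ_ = ≡-dec Bool._≟_

  open import Data.List.Membership.DecPropositional _≟ₛ_ using () renaming (_∈?_ to _∈ˡ?_)

  template : Fin q → Subset n
  template i = tabulate (row (toℕ i))

  realises : Fin q → Fin (length F) → Vector (Fin n) n → ℕ
  realises i j π = 𝟙 (matches (lookup (List.lookup F j)) π (template i))

  realisations : Vector (Fin n) n → ℕ
  realisations π = ∑[ i < q ] ∑[ j < length F ] realises i j π

  module _ (π : Vector (Fin n) n) (covers : Covers id π) where

    π⁻¹ : Fin n → Fin n
    π⁻¹ x = proj₁ (covers x)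

    image : Fin q → Subset n
    image i = tabulate (λ x → row (toℕ i) (π⁻¹ x))

    matches⇒≡image : ∀ i A → matches (lookup A) π (template i) ≡ true → A ≡ image i
    matches⇒≡image i A A-matches = trans (sym (tabulate∘lookup A)) (tabulate-cong λ x → begin
      lookup A x                  ≡⟨ cong (lookup A) (proj₂ (covers x)) ⟨
      lookup A (π (π⁻¹ x))        ≡⟨ matches⇒lookup (lookup A) π (template i) A-matches (π⁻¹ x) ⟩
      lookup (template i) (π⁻¹ x) ≡⟨ lookup∘tabulate (row (toℕ i)) (π⁻¹ x) ⟩
      row (toℕ i) (π⁻¹ x)         ∎)
      where open ≡-Reasoning

    realises≤𝟙[≡image] : ∀ i j → realises i j π ≤ 𝟙 (does (List.lookup F j ≟ₛ image i))
    realises≤𝟙[≡image] i j with matches (lookup (List.lookup F j)) π (template i) in Fⱼ-matches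
    ... | false = z≤n
    ... | true  = ≤-reflexive (cong 𝟙 (sym (dec-true (Fⱼ ≟ₛ image i) (matches⇒≡image i Fⱼ Fⱼ-matches))))
      where
      Fⱼ : Subset n
      Fⱼ = List.lookup F j

    in-F : Vector Bool q
    in-F i = isYes (image i ∈ˡ? F)

    realisations≤count : realisations π ≤ count in-F
    realisations≤count = sum-mono-≤ λ i →
      ≤-trans (sum-mono-≤ (realises≤𝟙[≡image] i)) (multiplicity-≤-∈ _≟ₛ_ (image i) F-unique)

    count<l : count in-F < l
    count<l = ≰⇒> λ l≤count → let e , e∈F , e-count = select l in-F l≤count in
      F-free (image ∘ e) (λ k → toWitness {a? = image (e k) ∈ˡ? F} (e∈F k))
        (disjCov-from-degrees (λ k x → row (toℕ (e k)) (π⁻¹ x)) s₁ s₂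
          (λ x → ≤-trans (e-count (column q (π⁻¹ x))) (count-column-≤ q (π⁻¹ x) qt≤s₁n))
          (λ x → ≤-trans (e-count (not ∘ column q (π⁻¹ x))) (count-column-complement-≤ q (π⁻¹ x) q[n∸t]≤s₂n)))

    realisations≤l∸1 : realisations π ≤ l ∸ 1
    realisations≤l∸1 = <⇒≤pred (≤-<-trans realisations≤count count<l)

  K : ℕ
  K = t ! * (n ∸ t) !

  instance
    K≢0 : NonZero K
    K≢0 = t !* (n ∸ t) !≢0

  ∣template∣≡t : ∀ i → ∣ template i ∣ ≡ t
  ∣template∣≡t i = trans (∣tabulate∣≡count (row (toℕ i))) (count-row (toℕ i))

  arrangementSum-realises : ∀ i j → arrangementSum id (realises i j) ≡ K
  arrangementSum-realises i j = begin
    arrangementSum id (realises i j)         ≡⟨ arrangementSum-matches (lookup A) id (template i) count≡∣template∣ ⟩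
    ∣ template i ∣ ! * ∣ ∁ (template i) ∣ !  ≡⟨ cong (λ c → c ! * ∣ ∁ (template i) ∣ !) (∣template∣≡t i) ⟩
    t ! * ∣ ∁ (template i) ∣ !               ≡⟨ cong (λ c → t ! * c !) (∣∁p∣≡n∸∣p∣ (template i)) ⟩
    t ! * (n ∸ ∣ template i ∣) !             ≡⟨ cong (λ c → t ! * (n ∸ c) !) (∣template∣≡t i) ⟩
    K                                        ∎
    where
    open ≡-Reasoning
    A : Subset n
    A = List.lookup F j
    count≡∣template∣ : count (lookup A) ≡ ∣ template i ∣
    count≡∣template∣ = trans (sym (∣p∣≡count A)) (trans (All.lookup F-sizes (∈-lookup j)) (sym (∣template∣≡t i)))

  arrangementSum-realisations : arrangementSum id realisations ≡ q * (length F * K)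
  arrangementSum-realisations = begin
    arrangementSum id realisations                                 ≡⟨ arrangementSum-∑ id q (λ i π → ∑[ j < length F ] realises i j π) ⟩
    ∑[ i < q ] arrangementSum id (λ π → ∑[ j < length F ] realises i j π)
                                                                   ≡⟨ sum-cong-≗ {q} (λ i → arrangementSum-∑ id (length F) (realises i)) ⟩
    ∑[ i < q ] ∑[ j < length F ] arrangementSum id (realises i j)  ≡⟨ sum-cong-≗ {q} (λ i → sum-cong-≗ {length F} (arrangementSum-realises i)) ⟩
    ∑[ i < q ] ∑[ j < length F ] K                                 ≡⟨ sum-cong-≗ {q} (λ _ → sum-const (length F) K) ⟩
    ∑[ i < q ] (length F * K)                                      ≡⟨ sum-const q (length F * K) ⟩
    q * (length F * K)                                             ∎
    where open ≡-Reasoning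

  n!≡nCt*K : n ! ≡ (n C t) * K
  n!≡nCt*K = sym (trans (cong (_* K) (nCk≡n!/k![n-k]! t≤n)) (m/n*n≡m (k![n∸k]!∣n! t≤n)))

  q*∣F∣≤nCt*[l∸1] : q * length F ≤ (n C t) * (l ∸ 1)
  q*∣F∣≤nCt*[l∸1] = *-cancelʳ-≤ _ _ K (begin
    q * length F * K                ≡⟨ *-assoc q (length F) K ⟩
    q * (length F * K)              ≡⟨ arrangementSum-realisations ⟨
    arrangementSum id realisations  ≤⟨ arrangementSum-≤ id realisations (l ∸ 1) realisations≤l∸1 ⟩
    n ! * (l ∸ 1)                   ≡⟨ cong (_* (l ∸ 1)) n!≡nCt*K ⟩
    (n C t) * K * (l ∸ 1)           ≡⟨ xy∙z≈xz∙y (n C t) K (l ∸ 1) ⟩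
    (n C t) * (l ∸ 1) * K           ∎)
    where open ≤-Reasoning

m≤⌈m/n⌉*n : ∀ m n .{{_ : NonZero n}} → m ≤ ⌈ m / n ⌉ * n
m≤⌈m/n⌉*n m n@(suc d) = +-cancelʳ-≤ d m _ (begin
  m + d                        ≡⟨ m≡m%n+[m/n]*n (m + d) n ⟩
  (m + d) % n + ⌈ m / n ⌉ * n  ≤⟨ +-monoˡ-≤ _ (s≤s⁻¹ (m%n<n (m + d) n)) ⟩
  d + ⌈ m / n ⌉ * n            ≡⟨ +-comm d _ ⟩
  ⌈ m / n ⌉ * n + d            ∎)
  where open ≤-Reasoning

⌈m/n⌉≤m : ∀ m n .{{_ : NonZero n}} → ⌈ m / n ⌉ ≤ m
⌈m/n⌉≤m m n@(suc d) = s≤s⁻¹ (m<n*o⇒m/o<n (begin-strict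
  m + d      <⟨ +-monoʳ-< m (n<1+n d) ⟩
  m + n      ≤⟨ +-monoˡ-≤ n (m≤m*n m n) ⟩
  m * n + n  ≡⟨ +-comm (m * n) n ⟩
  suc m * n  ∎))
  where open ≤-Reasoning

⌈m/n⌉>0 : ∀ {m} n .{{_ : NonZero n}} → m > 0 → ⌈ m / n ⌉ > 0
⌈m/n⌉>0 n@(suc d) m>0 = m≥n⇒m/n>0 (+-monoˡ-≤ d m>0)

[n/χ]*t≤s*n : ∀ {n t s} χ .{{_ : NonZero χ}} → t ≤ χ * s → n / χ * t ≤ s * n
[n/χ]*t≤s*n {n} {t} {s} χ t≤χs = begin
  n / χ * t        ≤⟨ *-monoʳ-≤ (n / χ) t≤χs ⟩
  n / χ * (χ * s)  ≡⟨ *-assoc (n / χ) χ s ⟨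
  n / χ * χ * s    ≤⟨ *-monoˡ-≤ s (m/n*n≤m n χ) ⟩
  n * s            ≡⟨ *-comm n s ⟩
  s * n            ∎
  where open ≤-Reasoning

q*m≤b⇒n*m≤b*⌈n/q⌉ : ∀ n q m b .{{_ : NonZero q}} → q * m ≤ b → n * m ≤ b * ⌈ n / q ⌉
q*m≤b⇒n*m≤b*⌈n/q⌉ n q m b qm≤b = begin
  n * m                ≤⟨ *-monoˡ-≤ m (m≤⌈m/n⌉*n n q) ⟩
  ⌈ n / q ⌉ * q * m    ≡⟨ *-assoc ⌈ n / q ⌉ q m ⟩
  ⌈ n / q ⌉ * (q * m)  ≤⟨ *-monoʳ-≤ ⌈ n / q ⌉ qm≤b ⟩
  ⌈ n / q ⌉ * b        ≡⟨ *-comm ⌈ n / q ⌉ b ⟩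
  b * ⌈ n / q ⌉        ∎
  where open ≤-Reasoning

n*∣F∣≤nCt*[l∸1]*⌈n/⌊n/χ⌋⌉ : ∀ {n t l s₁ s₂} χ .{{_ : NonZero n}} .{{_ : NonZero χ}} →
                             χ ≤ n → t ≤ n → t ≤ χ * s₁ → n ∸ t ≤ χ * s₂ →
                             (F : List (Subset n)) → Admissible n t l (s₁ + 1) (s₂ + 1) F →
                             n * length F ≤ (n C t) * (l ∸ 1) * ⌈ n / ⌊ n / χ ⌋ ⌉
n*∣F∣≤nCt*[l∸1]*⌈n/⌊n/χ⌋⌉ {n} {t} {l} {s₁} {s₂} χ@(suc _) χ≤n t≤n t≤χs₁ n∸t≤χs₂ F (F-unique , F-sizes , F-free) =
  q*m≤b⇒n*m≤b*⌈n/q⌉ n q (length F) _ {{>-nonZero (m≥n⇒m/n>0 χ≤n)}}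
    (DoubleCounting.q*∣F∣≤nCt*[l∸1] n t q s₁ s₂ l t≤n ([n/χ]*t≤s*n χ t≤χs₁) ([n/χ]*t≤s*n χ n∸t≤χs₂)
      F F-unique F-sizes F-free)
  where
  q : ℕ
  q = n / χ

theorem5p1 : (n t l s₁ s₂ : ℕ) → 1 ≤ s₁ → 1 ≤ s₂ → 1 < t → t < n →
    (s₁ + 1) ⊓ (s₂ + 1) ≤ l → l ≤ s₁ + s₂ →
    (F : List (Subset n)) → Admissible n t l (s₁ + 1) (s₂ + 1) F →
    n * length F ≤ (n C t) * (l ∸ 1) * ⌈ n / ⌊ n / (⌈ t / s₁ ⌉ ⊔ ⌈ (n ∸ t) / s₂ ⌉) ⌋ ⌉
theorem5p1 n t l s₁ s₂ s₁≥1 s₂≥1 1<t t<n _ _ = n*∣F∣≤nCt*[l∸1]*⌈n/⌊n/χ⌋⌉ χ χ≤n (<⇒≤ t<n)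
  (≤-trans (m≤⌈m/n⌉*n t s₁) (*-monoˡ-≤ s₁ (m≤m⊔n ⌈ t / s₁ ⌉ ⌈ (n ∸ t) / s₂ ⌉)))
  (≤-trans (m≤⌈m/n⌉*n (n ∸ t) s₂) (*-monoˡ-≤ s₂ (m≤n⊔m ⌈ t / s₁ ⌉ ⌈ (n ∸ t) / s₂ ⌉)))
  where
  χ : ℕ
  χ = ⌈ t / s₁ ⌉ ⊔ ⌈ (n ∸ t) / s₂ ⌉
  instance
    n≢0 : NonZero n
    n≢0 = >-nonZero (≤-<-trans z≤n t<n)
    s₁≢0 : NonZero s₁
    s₁≢0 = >-nonZero s₁≥1
    s₂≢0 : NonZero s₂
    s₂≢0 = >-nonZero s₂≥1
    χ≢0 : NonZero χ
    χ≢0 = >-nonZero (≤-trans (⌈m/n⌉>0 s₁ (<⇒≤ 1<t)) (m≤m⊔n _ _))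
  χ≤n : χ ≤ n
  χ≤n = ⊔-lub (≤-trans (⌈m/n⌉≤m t s₁) (<⇒≤ t<n)) (≤-trans (⌈m/n⌉≤m (n ∸ t) s₂) (m∸n≤m n t))
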